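{- Let $k\ge1$, $k'=\lfloor (k-1)/3\rfloor$, and let $\tilde H$ be an unlabeled $k$-vertex pattern. Take any vertex of $\tilde H$ of degree at least $k'$ and any $k'$ edges $e_1,\dots,e_{k'}$ incident to it. Let $S$ be the set of (isomorphism types of) graphs obtained from $\tilde H$ by removing any subset of $\{e_1,\dots,e_{k'}\}$. Then there is a class $c$ with $U(c)=S$. Moreover $\alpha^c_{\tilde H}=|\mathrm{Aut}(\tilde H)|$ (i.e. $b^c_{\tilde H}=1$), and $\tilde H$ is the pattern in $U(c)$ with the maximum number of edges.
   Context: A labeled $k$-vertex pattern is a graph with a vertex ordering $(w_0,\dots,w_{k-1})$. The class $C(H)$ of a labeled pattern $H=(v_0,\dots,v_{k-1})$ consists of all labeled patterns $(w_0,\dots,w_{k-1})$ such that $v_iv_j\in E(H)$ iff $w_iw_j$ is an edge for every pair $\{i,j\}$ other than $\{0,1\},\dots,\{0,k'\}$. An unlabeled pattern embeds in class $c$ if some vertex ordering of it lies in $c$; $U(c)$ is the set of unlabeled patterns embedding in $c$; $\alpha^c_{\tilde H}$ is the number of vertex orderings of $\tilde H$ lying in $c$, and $b^c_{\tilde H}=\alpha^c_{\tilde H}/|\mathrm{Aut}(\tilde H)|$, where $\mathrm{Aut}$ denotes the automorphism group. -}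

module Defs where

open import Data.Bool using (Bool; true; false; _∧_; _∨_; not; T)
open import Data.Nat using (ℕ; zero; suc; _≤_; _<_; _∸_; _/_; _≡ᵇ_; _<ᵇ_; _≤ᵇ_)
open import Data.Fin using (Fin; toℕ)
open import Data.Fin.Properties using (_≟_)
open import Data.Vec using (Vec; []; _∷_; lookup)
open import Data.List using (List; []; _∷_; map; concatMap; filter; length; allFin)
open import Data.Bool.ListAction using (all; any)
open import Data.Product using (Σ; _×_; ∃)
open import Relation.Nullary.Decidable using (isYes; does)
open import Relation.Binary.PropositionalEquality using (_≡_)

Adj : ℕ → Set
Adj k = Fin k → Fin k → Bool

IsSimple : ∀ {k} → Adj k → Set
IsSimple A = (∀ i j → A i j ≡ A j i) × (∀ i → A i i ≡ false)

allF : ∀ {k} → (Fin k → Bool) → Bool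
allF {k} p = all p (allFin k)

anyF : ∀ {k} → (Fin k → Bool) → Bool
anyF {k} p = any p (allFin k)

_=ᶠ_ : ∀ {k} → Fin k → Fin k → Bool
i =ᶠ j = does (i ≟ j)

_=ᵇ_ : Bool → Bool → Bool
true  =ᵇ b = b
false =ᵇ b = not b

k′ : ℕ → ℕ
k′ k = (k ∸ 1) / 3

-- A vertex ordering (w_0,...,w_{k-1}) of a graph on Fin k: a vector listing
-- every vertex exactly once (injective, hence bijective).
isOrdering : ∀ {k} → Vec (Fin k) k → Bool
isOrdering w = allF λ i → allF λ j → not (lookup w i =ᶠ lookup w j) ∨ (i =ᶠ j)

allVecs : (n m : ℕ) → List (Vec (Fin m) n)
allVecs zero m = [] ∷ []
allVecs (suc n) m = concatMap (λ x → map (x ∷_) (allVecs n m)) (allFin m)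

-- The labeled pattern (w_0,...,w_{k-1}) determined by graph G and ordering w:
-- positions i, j are adjacent iff w_i w_j is an edge of G.
relabel : ∀ {k} → Adj k → Vec (Fin k) k → Adj k
relabel G w i j = G (lookup w i) (lookup w j)

exempt : (k : ℕ) → Fin k → Fin k → Bool
exempt k i j = exempt′ i j ∨ exempt′ j i
  where
  exempt′ : Fin k → Fin k → Bool
  exempt′ a b = (toℕ a ≡ᵇ 0) ∧ (1 ≤ᵇ toℕ b) ∧ (toℕ b ≤ᵇ k′ k)

inClass : ∀ {k} → Adj k → Adj k → Bool
inClass {k} H L = allF λ i → allF λ j → exempt k i j ∨ (H i j =ᵇ L i j)

-- The unlabeled pattern (isomorphism type of) G embeds in class C(H):
-- some vertex ordering of G lies in C(H).
EmbedsIn : ∀ {k} → Adj k → Adj k → Set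
EmbedsIn {k} G H = Σ (Vec (Fin k) k) λ w → T (isOrdering w) × T (inClass H (relabel G w))

Iso : ∀ {k} → Adj k → Adj k → Set
Iso {k} G G' = Σ (Vec (Fin k) k) λ w → T (isOrdering w) × (∀ i j → relabel G w i j ≡ G' i j)

alpha : ∀ {k} → Adj k → Adj k → ℕ
alpha {k} H G = length (filter (λ w → T? (isOrdering w ∧ inClass H (relabel G w))) (allVecs k k))
  where
  open import Relation.Nullary using (Dec; yes; no)
  T? : (b : Bool) → Dec (T b)
  T? true = yes _
  T? false = no λ ()

autCount : ∀ {k} → Adj k → ℕ
autCount {k} G = length (filter (λ w → T? (isOrdering w ∧ (allF λ i → allF λ j → relabel G w i j =ᵇ G i j))) (allVecs k k))
  where
  open import Relation.Nullary using (Dec; yes; no)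
  T? : (b : Bool) → Dec (T b)
  T? true = yes _
  T? false = no λ ()

edgeCount : ∀ {k} → Adj k → ℕ
edgeCount {k} G = length (filter (λ p → T? p) (concatMap (λ i → map (λ j → (toℕ i <ᵇ toℕ j) ∧ G i j) (allFin k)) (allFin k)))
  where
  open import Relation.Nullary using (Dec; yes; no)
  T? : (b : Bool) → Dec (T b)
  T? true = yes _
  T? false = no λ ()

removeEdges : ∀ {k k'} → Adj k → Fin k → (Fin k' → Fin k) → (Fin k' → Bool) → Adj k
removeEdges G u nb R i j =
  G i j ∧ not (any (λ m → R m ∧ (((i =ᶠ u) ∧ (j =ᶠ nb m)) ∨ ((j =ᶠ u) ∧ (i =ᶠ nb m)))) (allFin _))

-- Choose a permutation σ of the positions with σ 0 = u and σ (1 + m) = nb m, and put H₀ := H ∘ σ,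
-- a labelled copy of H in which every exempt pair {0, 1 + m} is the edge {u, nb m}. A labelled
-- pattern lies in C(H₀) iff it agrees with H₀ off the exempt pairs, i.e. iff it is H₀ with some of
-- these edges deleted; transporting back along σ, these are exactly the graphs H minus some of the
-- chosen edges. So every member of C(H₀) is a subgraph of H₀, with at most as many edges as H and
-- equality only for H₀ itself. In particular an ordering w of H lies in C(H₀) iff H ∘ w = H ∘ σ,
-- i.e. iff w ∘ σ⁻¹ is an automorphism of H; as w ↦ w ∘ σ⁻¹ is a bijection, α = |Aut H|.
module Submission where

open import Defs
open import Data.Bool using (Bool; true; false; T; not; _∧_; _∨_)
open import Data.Bool.ListAction using (any; or)
open import Data.Bool.Properties using (T?; T-∧; T-∨; ∧-identityʳ; not-involutive)
open import Data.Empty using (⊥-elim)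
open import Data.Fin using (Fin; zero; suc; toℕ; inject≤; fromℕ<; punchOut)
open import Data.Fin.Properties
  using ( _≟_; any?; punchOut-injective; injective⇒≤; suc-injective; inject≤-injective
        ; toℕ-injective; toℕ-inject≤; toℕ-fromℕ<; toℕ<n)
open import Data.Fin.Permutation
  using (Permutation′; permutation; _⟨$⟩ʳ_; _⟨$⟩ˡ_; _∘ₚ_; transpose; inverseˡ; inverseʳ; id; flip)
open import Data.List
  using (List; []; _∷_; map; filter; length; cartesianProduct; concatMap; _++_; allFin)
open import Data.List.Properties using (filter-≐; map-++; map-∘; map-cong)
open import Data.List.Membership.Propositional using (_∈_; lose)
open import Data.List.Membership.Propositional.Properties
  using (∈-map⁺; ∈-filter⁺; ∈-filter⁻; ∈-cartesianProduct⁺; ∈-allFin)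
open import Data.List.Membership.Propositional.Properties.WithK using (unique∧set⇒bag)
open import Data.List.Relation.Binary.BagAndSetEquality using (∼bag⇒↭)
open import Data.List.Relation.Binary.Permutation.Propositional using (_↭_)
open import Data.List.Relation.Binary.Permutation.Propositional.Properties
  using (filter-↭; ↭-length)
open import Data.List.Relation.Binary.Pointwise using (Pointwise-≡⇒≡)
open import Data.List.Relation.Binary.Sublist.Heterogeneous using (Sublist)
open import Data.List.Relation.Binary.Sublist.Heterogeneous.Properties
  using (⊆-filter-Sublist; length-mono-≤; toPointwise)
open import Data.List.Relation.Binary.Sublist.Propositional using (⊆-refl)
open import Data.List.Relation.Unary.All as All using ([])
open import Data.List.Relation.Unary.All.Properties using (all⁺; all⁻; tabulate⁺)
open import Data.List.Relation.Unary.AllPairs using ([]; _∷_)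
open import Data.List.Relation.Unary.Any as Any using (here)
open import Data.List.Relation.Unary.Any.Properties using (any⁺; any⁻)
open import Data.List.Relation.Unary.Unique.Propositional using (Unique)
import Data.List.Relation.Unary.Unique.Propositional.Properties as Unique
open import Data.Nat using (ℕ; zero; suc; _≤_; _<_; _+_; _*_; _≡ᵇ_; _≤ᵇ_; _<ᵇ_)
open import Data.Nat.DivMod using (m/n≤m)
open import Data.Nat.Properties
  using (+-suc; *-identityˡ; 1+n≰n; <ᵇ⇒<; <⇒<ᵇ; _<?_; ≤∧≢⇒<; ≮⇒≥; <-asym; *-cancelˡ-≤)
open import Data.Product using (Σ; ∃; _×_; _,_; proj₁; proj₂; uncurry; swap)
open import Data.Product.Algebra using (×-comm)
open import Data.Product.Function.NonDependent.Propositional using (_×-↔_)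
open import Data.Sum using (_⊎_; inj₁; inj₂)
open import Data.Vec using (Vec; []; _∷_; lookup; tabulate; uncons)
open import Data.Vec.Functional using () renaming (_∷_ to _∷ᶠ_)
open import Data.Vec.Properties using (lookup∘tabulate; tabulate∘lookup; tabulate-cong)
open import Function using (_∘_; _⇔_; mk⇔; _↔_; mk↔ₛ′; Equivalence; Inverse)
open import Function.Definitions using (Injective)
open import Level using (Level; 0ℓ)
open import Relation.Binary.PropositionalEquality
  using (_≡_; _≢_; refl; sym; trans; cong; cong₂; subst; subst₂; module ≡-Reasoning)
open import Relation.Nullary using (¬_; yes; no; does)
open import Relation.Nullary.Decidable using (dec-true; dec-false)
open import Relation.Unary using (Pred; Decidable; _⊆_; _≐_)
open import Relation.Unary.Properties using (_∩?_; ∁?)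

open Equivalence using (to; from)

private variable
  a b c p q : Level
  A B C : Set a
  d k m n : ℕ

-- Counting over enumerations

count : {P : Pred A p} → Decidable P → List A → ℕ
count P? = length ∘ filter P?

module _ {P : Pred A p} (P? : Decidable P) where

  count-↭ : {xs ys : List A} → xs ↭ ys → count P? xs ≡ count P? ys
  count-↭ = ↭-length ∘ filter-↭ P?

  count-map : (f : B → A) (xs : List B) → count P? (map f xs) ≡ count (P? ∘ f) xs
  count-map f [] = refl
  count-map f (x ∷ xs) with does (P? (f x))
  ... | true  = cong suc (count-map f xs)
  ... | false = count-map f xs

module _ {P : Pred A p} {Q : Pred A q} (P? : Decidable P) (Q? : Decidable Q) where

  count-≐ : P ≐ Q → (xs : List A) → count P? xs ≡ count Q? xs
  count-≐ P≐Q xs = cong length (filter-≐ P? Q? P≐Q xs)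

  filter-⊆ : P ⊆ Q → (xs : List A) → Sublist _≡_ (filter P? xs) (filter Q? xs)
  filter-⊆ P⊆Q xs = ⊆-filter-Sublist P? Q? (λ { refl → P⊆Q }) (⊆-refl {x = xs})

  count-mono : P ⊆ Q → (xs : List A) → count P? xs ≤ count Q? xs
  count-mono P⊆Q xs = length-mono-≤ (filter-⊆ P⊆Q xs)

  -- A sublist of equal length is the whole list, so the two filters coincide.
  count-≡⇒⊇ : P ⊆ Q → {xs : List A} → count P? xs ≡ count Q? xs → ∀ {x} → x ∈ xs → Q x → P x
  count-≡⇒⊇ P⊆Q {xs} eq x∈xs Qx =
    proj₂ (∈-filter⁻ P? {xs = xs} (subst (_ ∈_) (sym filters-equal) (∈-filter⁺ Q? x∈xs Qx)))
    where
    filters-equal : filter P? xs ≡ filter Q? xs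
    filters-equal = Pointwise-≡⇒≡ (toPointwise eq (filter-⊆ P⊆Q xs))

  count-split : (xs : List A) → count P? xs ≡ count (P? ∩? Q?) xs + count (P? ∩? ∁? Q?) xs
  count-split [] = refl
  count-split (x ∷ xs) with P? x | Q? x
  ... | yes _ | yes _ = cong suc (count-split xs)
  ... | yes _ | no _  = trans (cong suc (count-split xs)) (sym (+-suc _ _))
  ... | no _  | yes _ = count-split xs
  ... | no _  | no _  = count-split xs

Enumerates : {A : Set a} → List A → Set a
Enumerates xs = Unique xs × (∀ x → x ∈ xs)

enumerations-↭ : {xs ys : List A} → Enumerates xs → Enumerates ys → xs ↭ ys
enumerations-↭ (xs! , ∈xs) (ys! , ∈ys) =
  ∼bag⇒↭ (unique∧set⇒bag xs! ys! (mk⇔ (λ _ → ∈ys _) (λ _ → ∈xs _)))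

map-enumerates : (f : A ↔ B) {xs : List A} → Enumerates xs → Enumerates (map (Inverse.to f) xs)
map-enumerates f (xs! , ∈xs) = Unique.map⁺ f-injective xs! , ∈map
  where
  open Inverse f using (strictlyInverseˡ; strictlyInverseʳ)
  f-injective : ∀ {x y} → Inverse.to f x ≡ Inverse.to f y → x ≡ y
  f-injective {x} {y} eq =
    trans (sym (strictlyInverseʳ x)) (trans (cong (Inverse.from f) eq) (strictlyInverseʳ y))
  ∈map : ∀ y → y ∈ map (Inverse.to f) _
  ∈map y = subst (_∈ _) (strictlyInverseˡ y) (∈-map⁺ (Inverse.to f) (∈xs (Inverse.from f y)))

count-∘-inverse : {P : Pred B p} (P? : Decidable P) (f : A ↔ B) {xs : List A} {ys : List B} →
                  Enumerates xs → Enumerates ys → count (P? ∘ Inverse.to f) xs ≡ count P? ys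
count-∘-inverse P? f {xs} xs-enum ys-enum = trans (sym (count-map P? (Inverse.to f) xs))
  (count-↭ P? (enumerations-↭ (map-enumerates f xs-enum) ys-enum))

cartesianProduct-enumerates : {xs : List A} {ys : List B} →
                              Enumerates xs → Enumerates ys → Enumerates (cartesianProduct xs ys)
cartesianProduct-enumerates (xs! , ∈xs) (ys! , ∈ys) =
  Unique.cartesianProduct⁺ xs! ys! , λ (x , y) → ∈-cartesianProduct⁺ (∈xs x) (∈ys y)

concatMap-map≡map-cartesianProduct : (f : A → B → C) (xs : List A) (ys : List B) →
  concatMap (λ x → map (f x) ys) xs ≡ map (uncurry f) (cartesianProduct xs ys)
concatMap-map≡map-cartesianProduct f [] ys = refl
concatMap-map≡map-cartesianProduct f (x ∷ xs) ys = trans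
  (cong₂ _++_ (map-∘ ys) (concatMap-map≡map-cartesianProduct f xs ys))
  (sym (map-++ (uncurry f) (map (x ,_) ys) _))

-- Permutations of Fin n

injective⇒surjective : {f : Fin n → Fin n} → Injective _≡_ _≡_ f → ∀ y → ∃ λ x → f x ≡ y
injective⇒surjective {suc n} {f} f-inj y with any? (λ x → f x ≟ y)
... | yes hit = hit
... | no miss = ⊥-elim (1+n≰n (injective⇒≤ punchOut-injective′))
  where
  y≢f : ∀ x → y ≢ f x
  y≢f x eq = miss (x , sym eq)
  punchOut-injective′ : Injective _≡_ _≡_ (λ x → punchOut (y≢f x))
  punchOut-injective′ = f-inj ∘ punchOut-injective (y≢f _) (y≢f _)

injection⇒permutation : (f : Fin n → Fin n) → Injective _≡_ _≡_ f → Permutation′ n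
injection⇒permutation f f-inj =
  permutation f (proj₁ ∘ surj) (proj₂ ∘ surj) (λ x → f-inj (proj₂ (surj (f x))))
  where
  surj : ∀ y → ∃ λ x → f x ≡ y
  surj = injective⇒surjective f-inj

⟨$⟩ʳ-injective : (π : Permutation′ n) → Injective _≡_ _≡_ (π ⟨$⟩ʳ_)
⟨$⟩ʳ-injective π eq = trans (sym (inverseˡ π)) (trans (cong (π ⟨$⟩ˡ_) eq) (inverseˡ π))

transpose-matchˡ : (i j : Fin n) → transpose i j ⟨$⟩ʳ i ≡ j
transpose-matchˡ i j rewrite dec-true (i ≟ i) refl = refl

transpose-fixes : {i j x : Fin n} → x ≢ i → x ≢ j → transpose i j ⟨$⟩ʳ x ≡ x
transpose-fixes {i = i} {j} {x} x≢i x≢j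
  rewrite dec-false (x ≟ i) x≢i | dec-false (x ≟ j) x≢j = refl

injections⇒existsPermutation : (g f : Fin m → Fin n) →
                               Injective _≡_ _≡_ g → Injective _≡_ _≡_ f →
                               Σ (Permutation′ n) λ π → ∀ i → π ⟨$⟩ʳ g i ≡ f i
injections⇒existsPermutation {zero} g f _ _ = id , λ ()
injections⇒existsPermutation {suc m} {n} g f g-inj f-inj = π ∘ₚ τ , maps
  where
  IH : Σ (Permutation′ n) λ π → ∀ i → π ⟨$⟩ʳ g (suc i) ≡ f (suc i)
  IH = injections⇒existsPermutation (g ∘ suc) (f ∘ suc)
         (suc-injective ∘ g-inj) (suc-injective ∘ f-inj)
  π τ : Permutation′ n
  π = proj₁ IH
  τ = transpose (π ⟨$⟩ʳ g zero) (f zero)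
  maps : ∀ i → τ ⟨$⟩ʳ (π ⟨$⟩ʳ g i) ≡ f i
  maps zero = transpose-matchˡ (π ⟨$⟩ʳ g zero) (f zero)
  maps (suc i) = trans (cong (τ ⟨$⟩ʳ_) (proj₂ IH i)) (transpose-fixes ≢πg0 ≢f0)
    where
    ≢πg0 : f (suc i) ≢ π ⟨$⟩ʳ g zero
    ≢πg0 eq with g-inj (⟨$⟩ʳ-injective π (trans (proj₂ IH i) eq))
    ... | ()
    ≢f0 : f (suc i) ≢ f zero
    ≢f0 eq with f-inj eq
    ... | ()

∷-injective : {x : A} {f : Fin n → A} → Injective _≡_ _≡_ f → (∀ i → f i ≢ x) →
              Injective _≡_ _≡_ (x ∷ᶠ f)
∷-injective f-inj f≢x {zero}  {zero}  _  = refl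
∷-injective f-inj f≢x {zero}  {suc j} eq = ⊥-elim (f≢x j (sym eq))
∷-injective f-inj f≢x {suc i} {zero}  eq = ⊥-elim (f≢x i eq)
∷-injective f-inj f≢x {suc i} {suc j} eq = cong suc (f-inj eq)

-- Orderings, relabelling and class membership

T-ext : {a b : Bool} → (T a → T b) → (T b → T a) → a ≡ b
T-ext {false} {false} _ _ = refl
T-ext {false} {true}  _ b⇒a = ⊥-elim (b⇒a _)
T-ext {true}  {false} a⇒b _ = ⊥-elim (a⇒b _)
T-ext {true}  {true}  _ _ = refl

T-=ᵇ : {a b : Bool} → T (a =ᵇ b) ⇔ a ≡ b
T-=ᵇ {false} {false} = mk⇔ (λ _ → refl) (λ _ → _)
T-=ᵇ {false} {true}  = mk⇔ (λ ()) (λ ())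
T-=ᵇ {true}  {false} = mk⇔ (λ ()) (λ ())
T-=ᵇ {true}  {true}  = mk⇔ (λ _ → refl) (λ _ → _)

T-=ᶠ : {i j : Fin k} → T (i =ᶠ j) ⇔ i ≡ j
T-=ᶠ {i = i} {j} with i ≟ j
... | yes i≡j = mk⇔ (λ _ → i≡j) (λ _ → _)
... | no  i≢j = mk⇔ (λ ()) i≢j

T-not-∨ : {a b : Bool} → T (not a ∨ b) ⇔ (T a → T b)
T-not-∨ {false} = mk⇔ (λ _ ()) (λ _ → _)
T-not-∨ {true}  = mk⇔ (λ t _ → t) (λ f → f _)

T-∨⇔¬→ : {a b : Bool} → T (a ∨ b) ⇔ (¬ T a → T b)
T-∨⇔¬→ {false} = mk⇔ (λ t _ → t) (λ f → f (λ ()))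
T-∨⇔¬→ {true}  = mk⇔ (λ _ ¬t → ⊥-elim (¬t _)) (λ _ → _)

T-allF : {p : Fin k → Bool} → T (allF p) ⇔ (∀ i → T (p i))
T-allF {k} {p} = mk⇔ (λ t i → All.lookup (all⁺ p (allFin k) t) (∈-allFin i)) (all⁻ p ∘ tabulate⁺)

isOrdering⇔injective : (w : Vec (Fin k) k) → T (isOrdering w) ⇔ Injective _≡_ _≡_ (lookup w)
isOrdering⇔injective w = mk⇔
  (λ t {i} {j} eq → to T-=ᶠ (to T-not-∨ (to T-allF (to T-allF t i) j) (from T-=ᶠ eq)))
  (λ inj → from T-allF λ i → from T-allF λ j →
     from (T-not-∨ {lookup w i =ᶠ lookup w j}) (from T-=ᶠ ∘ inj ∘ to T-=ᶠ))

isOrdering-tabulate : {f : Fin k → Fin k} → Injective _≡_ _≡_ f → T (isOrdering (tabulate f))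
isOrdering-tabulate {f = f} f-inj = from (isOrdering⇔injective (tabulate f))
  λ {i} {j} eq → f-inj (trans (sym (lookup∘tabulate f i)) (trans eq (lookup∘tabulate f j)))

T-isOrdering-∧ : {w : Vec (Fin k) k} {b : Bool} →
                 T (isOrdering w ∧ b) ⇔ (Injective _≡_ _≡_ (lookup w) × T b)
T-isOrdering-∧ {w = w} {b} = mk⇔ split join
  where
  split : T (isOrdering w ∧ b) → Injective _≡_ _≡_ (lookup w) × T b
  split t = let o , t′ = to (T-∧ {isOrdering w}) t in to (isOrdering⇔injective w) o , t′
  join : Injective _≡_ _≡_ (lookup w) × T b → T (isOrdering w ∧ b)
  join (inj , t′) = from T-∧ (from (isOrdering⇔injective w) inj , t′)

relabelBy : Adj k → (Fin k → Fin k) → Adj k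
relabelBy G f i j = G (f i) (f j)

infix 4 _≋_ _⊆ᴬ_

_≋_ : Adj k → Adj k → Set
G ≋ G′ = ∀ i j → G i j ≡ G′ i j

_⊆ᴬ_ : Adj k → Adj k → Set
G ⊆ᴬ G′ = ∀ i j → T (G i j) → T (G′ i j)

T-allF-=ᵇ : {X Y : Adj k} → T (allF λ i → allF λ j → X i j =ᵇ Y i j) ⇔ X ≋ Y
T-allF-=ᵇ = mk⇔ (λ t i j → to T-=ᵇ (to T-allF (to T-allF t i) j))
                (λ X≋Y → from T-allF λ i → from T-allF λ j → from T-=ᵇ (X≋Y i j))

relabelBy-inverse : {X Y : Adj k} (π : Permutation′ k) →
                    relabelBy X (π ⟨$⟩ʳ_) ≋ Y → relabelBy Y (π ⟨$⟩ˡ_) ≋ X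
relabelBy-inverse {X = X} π eq i j = trans (sym (eq _ _)) (cong₂ X (inverseʳ π) (inverseʳ π))

iso-intro : {G G′ : Adj k} {f : Fin k → Fin k} → Injective _≡_ _≡_ f →
            relabelBy G f ≋ G′ → Iso G G′
iso-intro {G = G} {f = f} f-inj G∘f≋G′ = tabulate f , isOrdering-tabulate f-inj ,
  λ i j → trans (cong₂ G (lookup∘tabulate f i) (lookup∘tabulate f j)) (G∘f≋G′ i j)

inClass⇒agree : {H L : Adj k} → T (inClass H L) → ∀ i j → ¬ T (exempt k i j) → H i j ≡ L i j
inClass⇒agree {k} t i j ¬ex =
  to T-=ᵇ (to (T-∨⇔¬→ {exempt k i j}) (to T-allF (to T-allF t i) j) ¬ex)

agree⇒inClass : {H L : Adj k} → (∀ i j → ¬ T (exempt k i j) → H i j ≡ L i j) → T (inClass H L)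
agree⇒inClass {k} agree = from T-allF λ i → from T-allF λ j →
  from (T-∨⇔¬→ {exempt k i j}) (from T-=ᵇ ∘ agree i j)

inClass-cong : {H L L′ : Adj k} → L ≋ L′ → T (inClass H L) → T (inClass H L′)
inClass-cong {H = H} {L} {L′} L≋L′ t = agree⇒inClass {H = H} {L′} λ i j ¬ex →
  trans (inClass⇒agree {H = H} {L} t i j ¬ex) (L≋L′ i j)

embeds-intro : {G H : Adj k} {f : Fin k → Fin k} → Injective _≡_ _≡_ f →
               T (inClass H (relabelBy G f)) → EmbedsIn G H
embeds-intro {G = G} {H} {f} f-inj t = tabulate f , isOrdering-tabulate f-inj ,
  inClass-cong {H = H} (λ i j → sym (cong₂ G (lookup∘tabulate f i) (lookup∘tabulate f j))) t

reindex : {A : Set} → Permutation′ k → Vec A k ↔ Vec A k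
reindex {k} π =
  mk↔ₛ′ (λ w → tabulate (lookup w ∘ (π ⟨$⟩ʳ_))) (λ w → tabulate (lookup w ∘ (π ⟨$⟩ˡ_)))
  (cancel (λ _ → inverseˡ π)) (cancel (λ _ → inverseʳ π))
  where
  cancel : {A : Set} {f g : Fin k → Fin k} → (∀ i → g (f i) ≡ i) →
           (w : Vec A k) → tabulate (lookup (tabulate (lookup w ∘ g)) ∘ f) ≡ w
  cancel {g = g} gf≗id w = trans
    (tabulate-cong λ i → trans (lookup∘tabulate (lookup w ∘ g) _) (cong (lookup w) (gf≗id i)))
    (tabulate∘lookup w)

allFin-enumerates : (k : ℕ) → Enumerates (allFin k)
allFin-enumerates k = Unique.allFin⁺ k , ∈-allFin

allVecs-enumerates : (n m : ℕ) → Enumerates (allVecs n m)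
allVecs-enumerates zero m = [] ∷ [] , λ { [] → here refl }
allVecs-enumerates (suc n) m =
  subst Enumerates (sym (concatMap-map≡map-cartesianProduct _∷_ (allFin m) (allVecs n m)))
    (map-enumerates uncons⁻¹
      (cartesianProduct-enumerates (allFin-enumerates m) (allVecs-enumerates n m)))
  where
  uncons⁻¹ : (Fin m × Vec (Fin m) n) ↔ Vec (Fin m) (suc n)
  uncons⁻¹ = mk↔ₛ′ (uncurry _∷_) uncons (λ { (x ∷ xs) → refl }) (λ _ → refl)

-- Arc and edge counts

allPairs : (k : ℕ) → List (Fin k × Fin k)
allPairs k = cartesianProduct (allFin k) (allFin k)

allPairs-enumerates : (k : ℕ) → Enumerates (allPairs k)
allPairs-enumerates k = cartesianProduct-enumerates (allFin-enumerates k) (allFin-enumerates k)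

arcCount : Adj k → ℕ
arcCount {k} G = count (T? ∘ uncurry G) (allPairs k)

arcCount-relabelBy : (G : Adj k) (π : Permutation′ k) →
                     arcCount (relabelBy G (π ⟨$⟩ʳ_)) ≡ arcCount G
arcCount-relabelBy {k} G π =
  count-∘-inverse (T? ∘ uncurry G) (π ×-↔ π) (allPairs-enumerates k) (allPairs-enumerates k)

arcCount-relabel : (G : Adj k) {w : Vec (Fin k) k} → T (isOrdering w) →
                   arcCount (relabel G w) ≡ arcCount G
arcCount-relabel G {w} o =
  arcCount-relabelBy G (injection⇒permutation (lookup w) (to (isOrdering⇔injective w) o))

arcCount-mono : {G G′ : Adj k} → G ⊆ᴬ G′ → arcCount G ≤ arcCount G′
arcCount-mono {k} {G} {G′} G⊆G′ =
  count-mono (T? ∘ uncurry G) (T? ∘ uncurry G′) (λ {(i , j)} → G⊆G′ i j) (allPairs k)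

arcCount-≡⇒≋ : {G G′ : Adj k} → G ⊆ᴬ G′ → arcCount G ≡ arcCount G′ → G ≋ G′
arcCount-≡⇒≋ {k} {G} {G′} G⊆G′ eq i j = T-ext (G⊆G′ i j)
  (count-≡⇒⊇ (T? ∘ uncurry G) (T? ∘ uncurry G′) (λ {(i , j)} → G⊆G′ i j) eq
    (proj₂ (allPairs-enumerates k) (i , j)))

Ascending : Pred (Fin k × Fin k) 0ℓ
Ascending (i , j) = toℕ i < toℕ j

ascending? : Decidable (Ascending {k})
ascending? (i , j) = toℕ i <? toℕ j

edgeCount≡ascendingArcs : (G : Adj k) →
                          edgeCount G ≡ count ((T? ∘ uncurry G) ∩? ascending?) (allPairs k)
edgeCount≡ascendingArcs {k} G = trans
  (cong (count _) (concatMap-map≡map-cartesianProduct ascendingEdge (allFin k) (allFin k)))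
  (trans (count-map _ (uncurry ascendingEdge) (allPairs k))
         (count-≐ _ ((T? ∘ uncurry G) ∩? ascending?) (split , join) (allPairs k)))
  where
  ascendingEdge : Fin k → Fin k → Bool
  ascendingEdge i j = (toℕ i <ᵇ toℕ j) ∧ G i j
  split : ∀ {q} → T (uncurry ascendingEdge q) → T (uncurry G q) × Ascending q
  split {i , j} t = let i<ᵇj , e = to T-∧ t in e , <ᵇ⇒< (toℕ i) (toℕ j) i<ᵇj
  join : ∀ {q} → T (uncurry G q) × Ascending q → T (uncurry ascendingEdge q)
  join (e , i<j) = from T-∧ (<⇒<ᵇ i<j , e)

arcCount≡2*edgeCount : (G : Adj k) → IsSimple G → arcCount G ≡ 2 * edgeCount G
arcCount≡2*edgeCount {k} G (G-sym , G-loopless) = begin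
  arcCount G
    ≡⟨ count-split (T? ∘ uncurry G) ascending? (allPairs k) ⟩
  count ascendingArc? (allPairs k) + count descendingArc? (allPairs k)
    ≡⟨ cong (count ascendingArc? (allPairs k) +_) (sym ascending≡descending) ⟩
  count ascendingArc? (allPairs k) + count ascendingArc? (allPairs k)
    ≡⟨ cong₂ _+_ (sym edges) (trans (sym edges) (sym (*-identityˡ _))) ⟩
  2 * edgeCount G
    ∎
  where
  open ≡-Reasoning
  ascendingArc? : Decidable (λ q → T (uncurry G q) × Ascending q)
  ascendingArc? = (T? ∘ uncurry G) ∩? ascending?
  descendingArc? : Decidable (λ q → T (uncurry G q) × ¬ Ascending q)
  descendingArc? = (T? ∘ uncurry G) ∩? ∁? ascending?
  edges : edgeCount G ≡ count ascendingArc? (allPairs k)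
  edges = edgeCount≡ascendingArcs G
  reverse : ∀ {q} → T (uncurry G (swap q)) × Ascending (swap q) → T (uncurry G q) × ¬ Ascending q
  reverse {i , j} (e , j<i) = subst T (G-sym j i) e , <-asym j<i
  unreverse : ∀ {q} → T (uncurry G q) × ¬ Ascending q → T (uncurry G (swap q)) × Ascending (swap q)
  unreverse {i , j} (e , i≮j) = subst T (G-sym i j) e , ≤∧≢⇒< (≮⇒≥ i≮j) j≢i
    where
    j≢i : toℕ j ≢ toℕ i
    j≢i eq = subst T (trans (cong (λ x → G x j) (toℕ-injective (sym eq))) (G-loopless j)) e
  ascending≡descending : count ascendingArc? (allPairs k) ≡ count descendingArc? (allPairs k)
  ascending≡descending = trans
    (sym (count-∘-inverse ascendingArc? (×-comm _ _)
           (allPairs-enumerates k) (allPairs-enumerates k)))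
    (count-≐ (ascendingArc? ∘ swap) descendingArc? (reverse , unreverse) (allPairs k))

-- Spokes and edge removal

data Spoke (u : Fin k) (nb : Fin d → Fin k) (m : Fin d) : Fin k → Fin k → Set where
  outward : Spoke u nb m u (nb m)
  inward  : Spoke u nb m (nb m) u

module _ {u : Fin k} {nb : Fin d → Fin k} {m : Fin d} {i j : Fin k} where

  outward-≡ : i ≡ u → j ≡ nb m → Spoke u nb m i j
  outward-≡ refl refl = outward

  inward-≡ : j ≡ u → i ≡ nb m → Spoke u nb m i j
  inward-≡ refl refl = inward

  Spoke⇒≡ : Spoke u nb m i j → (i ≡ u × j ≡ nb m) ⊎ (j ≡ u × i ≡ nb m)
  Spoke⇒≡ outward = inj₁ (refl , refl)
  Spoke⇒≡ inward  = inj₂ (refl , refl)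

Spoke-unique : {u : Fin k} {nb : Fin d → Fin k} → Injective _≡_ _≡_ nb → (∀ m → nb m ≢ u) →
               {m m′ : Fin d} {i j : Fin k} → Spoke u nb m i j → Spoke u nb m′ i j → m ≡ m′
Spoke-unique nb-inj nb≢u outward s with Spoke⇒≡ s
... | inj₁ (_ , nb≡nb) = nb-inj nb≡nb
... | inj₂ (nb≡u , _)  = ⊥-elim (nb≢u _ nb≡u)
Spoke-unique nb-inj nb≢u inward s with Spoke⇒≡ s
... | inj₁ (nb≡u , _)  = ⊥-elim (nb≢u _ nb≡u)
... | inj₂ (_ , nb≡nb) = nb-inj nb≡nb

Spoke-value : {u : Fin k} {nb : Fin d → Fin k} {L : Adj k} → (∀ i j → L i j ≡ L j i) →
              ∀ {m i j} → Spoke u nb m i j → L i j ≡ L u (nb m)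
Spoke-value L-sym outward = refl
Spoke-value L-sym inward  = L-sym _ _

Spoke-relabel : {u u′ : Fin k} {nb nb′ : Fin d → Fin k} {f : Fin k → Fin k} →
                Injective _≡_ _≡_ f → f u′ ≡ u → (∀ m → f (nb′ m) ≡ nb m) →
                ∀ {m i j} → Spoke u nb m (f i) (f j) ⇔ Spoke u′ nb′ m i j
Spoke-relabel {u = u} {u′} {nb} {nb′} {f} f-inj fu′≡u fnb′≡nb {m} {i} {j} = mk⇔ pull push
  where
  pull : Spoke u nb m (f i) (f j) → Spoke u′ nb′ m i j
  pull s with Spoke⇒≡ s
  ... | inj₁ (fi≡u , fj≡nb) =
    outward-≡ (f-inj (trans fi≡u (sym fu′≡u))) (f-inj (trans fj≡nb (sym (fnb′≡nb m))))
  ... | inj₂ (fj≡u , fi≡nb) =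
    inward-≡ (f-inj (trans fj≡u (sym fu′≡u))) (f-inj (trans fi≡nb (sym (fnb′≡nb m))))
  push : Spoke u′ nb′ m i j → Spoke u nb m (f i) (f j)
  push outward = outward-≡ fu′≡u (fnb′≡nb m)
  push inward  = inward-≡ fu′≡u (fnb′≡nb m)

-- Literally the test inside removeEdges, so that removeEdges unfolds to a statement about it.
spokeTest : Fin k → (Fin d → Fin k) → Fin k → Fin k → Fin d → Bool
spokeTest u nb i j m = ((i =ᶠ u) ∧ (j =ᶠ nb m)) ∨ ((j =ᶠ u) ∧ (i =ᶠ nb m))

T-spokeTest : {u : Fin k} {nb : Fin d → Fin k} {i j : Fin k} {m : Fin d} →
              T (spokeTest u nb i j m) ⇔ Spoke u nb m i j
T-spokeTest {u = u} {nb} {i} {j} {m} = mk⇔ decide witness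
  where
  decide : T (spokeTest u nb i j m) → Spoke u nb m i j
  decide t with to (T-∨ {(i =ᶠ u) ∧ (j =ᶠ nb m)}) t
  ... | inj₁ t′ = let i≡u , j≡nb = to (T-∧ {i =ᶠ u}) t′ in outward-≡ (to T-=ᶠ i≡u) (to T-=ᶠ j≡nb)
  ... | inj₂ t′ = let j≡u , i≡nb = to (T-∧ {j =ᶠ u}) t′ in inward-≡ (to T-=ᶠ j≡u) (to T-=ᶠ i≡nb)
  both : (x y : Fin _) → T ((x =ᶠ x) ∧ (y =ᶠ y))
  both x y = from T-∧ (from (T-=ᶠ {i = x}) refl , from (T-=ᶠ {i = y}) refl)
  witness : Spoke u nb m i j → T (spokeTest u nb i j m)
  witness outward = from T-∨ (inj₁ (both u (nb m)))
  witness inward  = from (T-∨ {(nb m =ᶠ u) ∧ (u =ᶠ nb m)}) (inj₂ (both u (nb m)))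

module _ {u : Fin k} {nb : Fin d → Fin k} (G : Adj k) (R : Fin d → Bool) where

  private
    removed : Fin k → Fin k → Bool
    removed i j = any (λ m → R m ∧ spokeTest u nb i j m) (allFin d)

    removed⇒Spoke : ∀ {i j} → T (removed i j) → ∃ λ m → T (R m) × Spoke u nb m i j
    removed⇒Spoke t with Any.satisfied (any⁻ _ (allFin d) t)
    ... | m , t′ = let r , s = to (T-∧ {R m}) t′ in m , r , to T-spokeTest s

  removeEdges-nonSpoke : ∀ {i j} → (∀ m → ¬ Spoke u nb m i j) → removeEdges G u nb R i j ≡ G i j
  removeEdges-nonSpoke {i} {j} ¬spoke = trans
    (cong (λ b → G i j ∧ not b)
      (T-ext (λ t → let m , _ , s = removed⇒Spoke t in ⊥-elim (¬spoke m s)) λ ()))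
    (∧-identityʳ (G i j))

  removeEdges-spoke : Injective _≡_ _≡_ nb → (∀ m → nb m ≢ u) →
                      ∀ {m i j} → Spoke u nb m i j → removeEdges G u nb R i j ≡ G i j ∧ not (R m)
  removeEdges-spoke nb-inj nb≢u {m} {i} {j} s = cong (λ b → G i j ∧ not b) (T-ext
    (λ t → let m′ , r , s′ = removed⇒Spoke t in subst (T ∘ R) (Spoke-unique nb-inj nb≢u s′ s) r)
    (λ r → any⁺ _ (lose (∈-allFin m) (from T-∧ (r , from T-spokeTest s)))))

relabelBy-removeEdges : {u u′ : Fin k} {nb nb′ : Fin d → Fin k} {f : Fin k → Fin k} →
  Injective _≡_ _≡_ f → f u′ ≡ u → (∀ m → f (nb′ m) ≡ nb m) →
  (G : Adj k) (R : Fin d → Bool) →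
  relabelBy (removeEdges G u nb R) f ≋ removeEdges (relabelBy G f) u′ nb′ R
relabelBy-removeEdges {d = d} {u = u} {u′} {nb} {nb′} {f} f-inj fu′≡u fnb′≡nb G R i j =
  cong (λ b → G (f i) (f j) ∧ not b)
    (cong or (map-cong (λ m → cong (R m ∧_) (same-test m)) (allFin d)))
  where
  spoke⇔ : ∀ {m} → Spoke u nb m (f i) (f j) ⇔ Spoke u′ nb′ m i j
  spoke⇔ = Spoke-relabel f-inj fu′≡u fnb′≡nb
  same-test : ∀ m → spokeTest u nb (f i) (f j) m ≡ spokeTest u′ nb′ i j m
  same-test m = T-ext (from T-spokeTest ∘ to spoke⇔ ∘ to T-spokeTest)
                      (from T-spokeTest ∘ from spoke⇔ ∘ to T-spokeTest)

-- The exempt pairs form a star at position 0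

k′≤n : (n : ℕ) → k′ (suc n) ≤ n
k′≤n n = m/n≤m n 3

leaf : (n : ℕ) → Fin (k′ (suc n)) → Fin (suc n)
leaf n m = suc (inject≤ m (k′≤n n))

private
  -- The one-sided test in the definition of exempt.
  Exempt′ : (n : ℕ) → Fin (suc n) → Fin (suc n) → Bool
  Exempt′ n a b = (toℕ a ≡ᵇ 0) ∧ (1 ≤ᵇ toℕ b) ∧ (toℕ b ≤ᵇ k′ (suc n))

  exempt′⇒leaf : (n : ℕ) {a b : Fin (suc n)} → T (Exempt′ n a b) →
                 a ≡ zero × ∃ λ m → b ≡ leaf n m
  exempt′⇒leaf n {zero} {suc b} t =
    refl , fromℕ< b<k′ , toℕ-injective (cong suc (sym toℕ-leaf))
    where
    b<k′ : toℕ b < k′ (suc n)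
    b<k′ = <ᵇ⇒< (toℕ b) _ t
    toℕ-leaf : toℕ (inject≤ (fromℕ< b<k′) (k′≤n n)) ≡ toℕ b
    toℕ-leaf = trans (toℕ-inject≤ _ (k′≤n n)) (toℕ-fromℕ< b<k′)

  leaf-exempt′ : (n : ℕ) (m : Fin (k′ (suc n))) → T (Exempt′ n zero (leaf n m))
  leaf-exempt′ n m = <⇒<ᵇ (subst (_< k′ (suc n)) (sym (toℕ-inject≤ m (k′≤n n))) (toℕ<n m))

exempt⇔Spoke : {i j : Fin (suc n)} → T (exempt (suc n) i j) ⇔ ∃ λ m → Spoke zero (leaf n) m i j
exempt⇔Spoke {n} {i} {j} = mk⇔ spoke exempt′
  where
  spoke : T (exempt (suc n) i j) → ∃ λ m → Spoke zero (leaf n) m i j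
  spoke t with to (T-∨ {Exempt′ n i j}) t
  ... | inj₁ t′ = let i≡0 , m , j≡leaf = exempt′⇒leaf n t′ in m , outward-≡ i≡0 j≡leaf
  ... | inj₂ t′ = let j≡0 , m , i≡leaf = exempt′⇒leaf n t′ in m , inward-≡ j≡0 i≡leaf
  exempt′ : (∃ λ m → Spoke zero (leaf n) m i j) → T (exempt (suc n) i j)
  exempt′ (m , outward) = from T-∨ (inj₁ (leaf-exempt′ n m))
  exempt′ (m , inward)  = from (T-∨ {Exempt′ n (leaf n m) zero}) (inj₂ (leaf-exempt′ n m))

-- The class of the relabelled pattern

module SpokeClass {n : ℕ} (H : Adj (suc n)) (H-simple : IsSimple H) (u : Fin (suc n))
  (nb : Fin (k′ (suc n)) → Fin (suc n)) (nb-inj : Injective _≡_ _≡_ nb)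
  (nb-edge : ∀ m → H u (nb m) ≡ true) where

  private
    K : ℕ
    K = suc n
    H-sym : ∀ i j → H i j ≡ H j i
    H-sym = proj₁ H-simple

  nb≢u : ∀ m → nb m ≢ u
  nb≢u m nb≡u with trans (sym (nb-edge m)) (trans (cong (H u) nb≡u) (proj₂ H-simple u))
  ... | ()

  leaf-injective : Injective _≡_ _≡_ (leaf n)
  leaf-injective = inject≤-injective _ _ _ _ ∘ suc-injective

  σ-spec : Σ (Permutation′ K) λ π → ∀ i → π ⟨$⟩ʳ (zero ∷ᶠ leaf n) i ≡ (u ∷ᶠ nb) i
  σ-spec = injections⇒existsPermutation (zero ∷ᶠ leaf n) (u ∷ᶠ nb)
    (∷-injective leaf-injective (λ _ ())) (∷-injective nb-inj nb≢u)

  σ : Permutation′ K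
  σ = proj₁ σ-spec

  σ-centre : σ ⟨$⟩ʳ zero ≡ u
  σ-centre = proj₂ σ-spec zero

  σ-leaf : ∀ m → σ ⟨$⟩ʳ leaf n m ≡ nb m
  σ-leaf = proj₂ σ-spec ∘ suc

  σ-injective : Injective _≡_ _≡_ (σ ⟨$⟩ʳ_)
  σ-injective = ⟨$⟩ʳ-injective σ

  σ⁻¹-injective : Injective _≡_ _≡_ (σ ⟨$⟩ˡ_)
  σ⁻¹-injective = ⟨$⟩ʳ-injective (flip σ)

  H₀ : Adj K
  H₀ = relabelBy H (σ ⟨$⟩ʳ_)

  H₀-simple : IsSimple H₀
  H₀-simple = (λ i j → H-sym _ _) , (λ i → proj₂ H-simple _)

  H₀-spoke : ∀ {m i j} → Spoke zero (leaf n) m i j → H₀ i j ≡ true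
  H₀-spoke s = H-spoke (from (Spoke-relabel σ-injective σ-centre σ-leaf) s)
    where
    H-spoke : ∀ {m x y} → Spoke u nb m x y → H x y ≡ true
    H-spoke {m} outward = nb-edge m
    H-spoke {m} inward  = trans (H-sym _ _) (nb-edge m)

  removeEdges-relabel : ∀ R → relabelBy (removeEdges H u nb R) (σ ⟨$⟩ʳ_) ≋
                              removeEdges H₀ zero (leaf n) R
  removeEdges-relabel = relabelBy-removeEdges σ-injective σ-centre σ-leaf H

  inClass⇒⊆ : {L : Adj K} → T (inClass H₀ L) → L ⊆ᴬ H₀
  inClass⇒⊆ {L} t i j l with T? (exempt K i j)
  ... | yes ex = let m , s = to exempt⇔Spoke ex in subst T (sym (H₀-spoke s)) _
  ... | no ¬ex = subst T (sym (inClass⇒agree {H = H₀} {L} t i j ¬ex)) l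

  inClass-maximal : {L : Adj K} → T (inClass H₀ L) → arcCount L ≡ arcCount H → L ≋ H₀
  inClass-maximal t eq = arcCount-≡⇒≋ (inClass⇒⊆ t) (trans eq (sym (arcCount-relabelBy H σ)))

  removeEdges-inClass : (R : Fin (k′ K) → Bool) → T (inClass H₀ (removeEdges H₀ zero (leaf n) R))
  removeEdges-inClass R = agree⇒inClass {H = H₀} {removeEdges H₀ zero (leaf n) R} λ i j ¬ex →
    sym (removeEdges-nonSpoke H₀ R λ m s → ¬ex (from exempt⇔Spoke (m , s)))

  inClass⇒removeEdges : {L : Adj K} → (∀ i j → L i j ≡ L j i) → T (inClass H₀ L) →
                        L ≋ removeEdges H₀ zero (leaf n) (λ m → not (L zero (leaf n m)))
  inClass⇒removeEdges {L} L-sym t i j with T? (exempt K i j)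
  ... | yes ex = let m , s = to exempt⇔Spoke ex in trans (Spoke-value L-sym s) (sym (begin
    removeEdges H₀ zero (leaf n) _ i j     ≡⟨ removeEdges-spoke H₀ _ leaf-injective (λ _ ()) s ⟩
    H₀ i j ∧ not (not (L zero (leaf n m))) ≡⟨ cong (_∧ _) (H₀-spoke s) ⟩
    not (not (L zero (leaf n m)))          ≡⟨ not-involutive _ ⟩
    L zero (leaf n m)                      ∎))
    where open ≡-Reasoning
  ... | no ¬ex = trans (sym (inClass⇒agree {H = H₀} {L} t i j ¬ex))
    (sym (removeEdges-nonSpoke H₀ _ λ m s → ¬ex (from exempt⇔Spoke (m , s))))

  embeds⇔removal : (G : Adj K) → IsSimple G →
                   EmbedsIn G H₀ ⇔ (Σ (Fin (k′ K) → Bool) λ R → Iso G (removeEdges H u nb R))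
  embeds⇔removal G G-simple = mk⇔ removal embedding
    where
    removal : EmbedsIn G H₀ → Σ (Fin (k′ K) → Bool) λ R → Iso G (removeEdges H u nb R)
    removal (w , o , t) = R , iso-intro {G = G} {f = lookup w ∘ (σ ⟨$⟩ˡ_)}
                                (σ⁻¹-injective ∘ to (isOrdering⇔injective w) o)
                                (relabelBy-inverse σ removal≋L)
      where
      R : Fin (k′ K) → Bool
      R m = not (relabel G w zero (leaf n m))
      removal≋L : relabelBy (removeEdges H u nb R) (σ ⟨$⟩ʳ_) ≋ relabel G w
      removal≋L i j = trans (removeEdges-relabel R i j)
        (sym (inClass⇒removeEdges {relabel G w} (λ _ _ → proj₁ G-simple _ _) t i j))
    embedding : (Σ (Fin (k′ K) → Bool) λ R → Iso G (removeEdges H u nb R)) → EmbedsIn G H₀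
    embedding (R , v , o , G∘v≋removal) = embeds-intro {G = G} {H₀} {lookup v ∘ (σ ⟨$⟩ʳ_)}
      (σ-injective ∘ to (isOrdering⇔injective v) o)
      (inClass-cong {H = H₀}
        (λ i j → trans (sym (removeEdges-relabel R i j)) (sym (G∘v≋removal _ _)))
        (removeEdges-inClass R))

  φ : Vec (Fin K) K → Vec (Fin K) K
  φ = Inverse.to (reindex (flip σ))

  lookup-φ : ∀ w i → lookup (φ w) i ≡ lookup w (σ ⟨$⟩ˡ i)
  lookup-φ w = lookup∘tabulate (lookup w ∘ (σ ⟨$⟩ˡ_))

  classOrdering⇔automorphism : (w : Vec (Fin K) K) →
    (Injective _≡_ _≡_ (lookup w) × T (inClass H₀ (relabel H w))) ⇔
    (Injective _≡_ _≡_ (lookup (φ w)) × relabel H (φ w) ≋ H)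
  classOrdering⇔automorphism w = mk⇔ automorphism classOrdering
    where
    automorphism : Injective _≡_ _≡_ (lookup w) × T (inClass H₀ (relabel H w)) →
                   Injective _≡_ _≡_ (lookup (φ w)) × relabel H (φ w) ≋ H
    automorphism (w-injective , t) = φw-injective , φw-automorphism
      where
      H∘w≋H₀ : relabel H w ≋ H₀
      H∘w≋H₀ = inClass-maximal {relabel H w} t
        (arcCount-relabel H {w} (from (isOrdering⇔injective w) w-injective))
      φw-injective : Injective _≡_ _≡_ (lookup (φ w))
      φw-injective {i} {j} eq =
        σ⁻¹-injective (w-injective (trans (sym (lookup-φ w i)) (trans eq (lookup-φ w j))))
      φw-automorphism : relabel H (φ w) ≋ H
      φw-automorphism i j = trans (cong₂ H (lookup-φ w i) (lookup-φ w j))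
        (relabelBy-inverse σ (λ i j → sym (H∘w≋H₀ i j)) i j)
    classOrdering : Injective _≡_ _≡_ (lookup (φ w)) × relabel H (φ w) ≋ H →
                    Injective _≡_ _≡_ (lookup w) × T (inClass H₀ (relabel H w))
    classOrdering (φw-injective , φw-automorphism) = w-injective ,
      inClass-cong {H = H₀} {H₀} (λ i j → sym (H∘w≋H₀ i j))
                   (agree⇒inClass {H = H₀} {H₀} λ _ _ _ → refl)
      where
      φw∘σ≡w : ∀ i → lookup (φ w) (σ ⟨$⟩ʳ i) ≡ lookup w i
      φw∘σ≡w i = trans (lookup-φ w (σ ⟨$⟩ʳ i)) (cong (lookup w) (inverseˡ σ))
      w-injective : Injective _≡_ _≡_ (lookup w)
      w-injective {i} {j} eq =
        σ-injective (φw-injective (trans (φw∘σ≡w i) (trans eq (sym (φw∘σ≡w j)))))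
      H∘w≋H₀ : relabel H w ≋ H₀
      H∘w≋H₀ i j = trans (sym (cong₂ H (φw∘σ≡w i) (φw∘σ≡w j))) (φw-automorphism _ _)

  alpha≡autCount : alpha H₀ H ≡ autCount H
  alpha≡autCount = trans (count-≐ _ _ equivalent (allVecs K K))
    (count-∘-inverse _ (reindex (flip σ)) (allVecs-enumerates K K) (allVecs-enumerates K K))
    where
    InClassOrdering IsAutomorphism : Vec (Fin K) K → Bool
    InClassOrdering v = isOrdering v ∧ inClass H₀ (relabel H v)
    IsAutomorphism v = isOrdering v ∧ (allF λ i → allF λ j → relabel H v i j =ᵇ H i j)
    T-InClassOrdering : ∀ v → T (InClassOrdering v) ⇔
                              (Injective _≡_ _≡_ (lookup v) × T (inClass H₀ (relabel H v)))
    T-InClassOrdering v = T-isOrdering-∧ {w = v}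
    T-IsAutomorphism : ∀ v → T (IsAutomorphism v) ⇔ (Injective _≡_ _≡_ (lookup v) × relabel H v ≋ H)
    T-IsAutomorphism v = mk⇔ unfold→ unfold←
      where
      unfold→ : T (IsAutomorphism v) → Injective _≡_ _≡_ (lookup v) × relabel H v ≋ H
      unfold→ t = let inj , t′ = to (T-isOrdering-∧ {w = v}) t in inj , to T-allF-=ᵇ t′
      unfold← : Injective _≡_ _≡_ (lookup v) × relabel H v ≋ H → T (IsAutomorphism v)
      unfold← (inj , a) = from (T-isOrdering-∧ {w = v}) (inj , from T-allF-=ᵇ a)
    equivalent : (T ∘ InClassOrdering) ≐ (T ∘ IsAutomorphism ∘ φ)
    equivalent =
      (λ {w} → from (T-IsAutomorphism (φ w)) ∘ to (classOrdering⇔automorphism w)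
                 ∘ to (T-InClassOrdering w)) ,
      (λ {w} → from (T-InClassOrdering w) ∘ from (classOrdering⇔automorphism w)
                 ∘ to (T-IsAutomorphism (φ w)))

  H-embeds : EmbedsIn H H₀
  H-embeds = embeds-intro {G = H} {H₀} σ-injective (agree⇒inClass {H = H₀} {H₀} λ _ _ _ → refl)

  embeds⇒fewerEdges : (G : Adj K) → IsSimple G → EmbedsIn G H₀ →
                      (edgeCount G ≤ edgeCount H) × (edgeCount G ≡ edgeCount H → Iso G H)
  embeds⇒fewerEdges G G-simple (w , o , t) = fewer , equal⇒iso
    where
    arcs-G : arcCount (relabel G w) ≡ 2 * edgeCount G
    arcs-G = trans (arcCount-relabel G {w} o) (arcCount≡2*edgeCount G G-simple)
    arcs-H : arcCount H₀ ≡ 2 * edgeCount H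
    arcs-H = trans (arcCount-relabelBy H σ) (arcCount≡2*edgeCount H H-simple)
    fewer : edgeCount G ≤ edgeCount H
    fewer = *-cancelˡ-≤ 2 (subst₂ _≤_ arcs-G arcs-H (arcCount-mono (inClass⇒⊆ {relabel G w} t)))
    equal⇒iso : edgeCount G ≡ edgeCount H → Iso G H
    equal⇒iso eq = iso-intro {G = G} {f = lookup w ∘ (σ ⟨$⟩ˡ_)}
      (σ⁻¹-injective ∘ to (isOrdering⇔injective w) o)
      (relabelBy-inverse σ λ i j → sym (inClass-maximal {relabel G w} t same-arcs i j))
      where
      same-arcs : arcCount (relabel G w) ≡ arcCount H
      same-arcs = trans arcs-G (trans (cong (2 *_) eq) (sym (arcCount≡2*edgeCount H H-simple)))

lemma3p6 : (k : ℕ) → 1 ≤ k → (H : Adj k) → IsSimple H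
    → (u : Fin k) → (nb : Fin (k′ k) → Fin k) → Injective _≡_ _≡_ nb
    → (∀ m → H u (nb m) ≡ true)
    → Σ (Adj k) λ H₀ → IsSimple H₀
      × (∀ (G : Adj k) → IsSimple G
           → (EmbedsIn G H₀ ⇔ (Σ (Fin (k′ k) → Bool) λ R → Iso G (removeEdges H u nb R))))
      × (alpha H₀ H ≡ autCount H)
      × EmbedsIn H H₀
      × (∀ (G : Adj k) → IsSimple G → EmbedsIn G H₀
           → (edgeCount G ≤ edgeCount H) × (edgeCount G ≡ edgeCount H → Iso G H))
lemma3p6 (suc n) _ H H-simple u nb nb-inj nb-edge =
  H₀ , H₀-simple , embeds⇔removal , alpha≡autCount , H-embeds , embeds⇒fewerEdges
  where open SpokeClass H H-simple u nb nb-inj nb-edge
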